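{- The equation $\neg\neg p=\top$ has no finite satisfiability gap in the class of Heyting algebras. Furthermore, for every finite Heyting algebra $H$ and every integer $k\geq1$, we have $\mathrm{ds}_{H\oplus_k\top}(\neg\neg p=\top)<1$, and $\lim_{k\to\infty}\mathrm{ds}_{H\oplus_k\top}(\neg\neg p=\top)=1$.
   Context: $\neg p$ abbreviates $p\to\bot$. For a Heyting algebra $H$, $H\oplus\top$ is the Heyting algebra obtained by adding a new element $\top$ above all elements of $H$ (the old top of $H$ remains as an ordinary element). $H\oplus_1\top := H\oplus\top$ and $H\oplus_k\top := (H\oplus_{k-1}\top)\oplus\top$. For a finite Heyting algebra $H$, $\mathrm{ds}_H(\varphi(p)) = |\{a\in H : H\models\varphi(a)\}|/|H|$. An equation has finite satisfiability gap if there is $\varepsilon>0$ such that for every finite Heyting algebra $H$, either $\mathrm{ds}_H=1$ or $\mathrm{ds}_H\le1-\varepsilon$. -}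

module Defs where

open import Data.Nat using (ℕ; zero; suc; _≥_)
open import Data.Fin using (Fin; zero; suc)
open import Data.Fin.Properties using (_≟_)
open import Data.List using (length; filter; allFin)
open import Data.Integer using (+_)
open import Data.Rational using (ℚ; _/_; 0ℚ; 1ℚ; _<_; _≤_; _-_; ∣_∣)
open import Data.Product using (Σ; ∃; ∃-syntax; _×_)
open import Data.Sum using (_⊎_)
open import Relation.Nullary using (¬_; yes; no)
open import Relation.Binary.PropositionalEquality using (_≡_)
open import Relation.Binary.Lattice.Structures using (IsHeytingAlgebra)
import Data.Unit as U
import Data.Empty as E

-- A finite Heyting-algebra signature whose carrier is Fin size
-- (every finite Heyting algebra is isomorphic to one of this form).
record RawFHA : Set₁ where
  field
    size : ℕ
    _≼_  : Fin size → Fin size → Set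
    _∨_  : Fin size → Fin size → Fin size
    _∧_  : Fin size → Fin size → Fin size
    _⇨_  : Fin size → Fin size → Fin size
    ⊤    : Fin size
    ⊥    : Fin size

IsFiniteHA : RawFHA → Set
IsFiniteHA H = IsHeytingAlgebra _≡_ _≼_ _∨_ _∧_ _⇨_ ⊤ ⊥
  where open RawFHA H

neg : (H : RawFHA) → Fin (RawFHA.size H) → Fin (RawFHA.size H)
neg H a = a ⇨ ⊥
  where open RawFHA H

countDN : RawFHA → ℕ
countDN H = length (filter (λ a → neg H (neg H a) ≟ RawFHA.⊤ H) (allFin (RawFHA.size H)))

-- a / d as a rational (d = 0 never occurs for Heyting algebras, since ⊤ exists)
ratio : ℕ → ℕ → ℚ
ratio a zero    = 0ℚ
ratio a (suc d) = + a / suc d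

ds : RawFHA → ℚ
ds H = ratio (countDN H) (RawFHA.size H)

-- H ⊕ ⊤ : the new top is  zero : Fin (suc n); the old element a is  suc a.
_⊕⊤ : RawFHA → RawFHA
H ⊕⊤ = record
  { size = suc size
  ; _≼_  = le
  ; _∨_  = jn
  ; _∧_  = mt
  ; _⇨_  = imp
  ; ⊤    = zero
  ; ⊥    = suc ⊥
  }
  where
  open RawFHA H
  le : Fin (suc size) → Fin (suc size) → Set
  le _       zero    = U.⊤
  le zero    (suc b) = E.⊥
  le (suc a) (suc b) = a ≼ b
  jn : Fin (suc size) → Fin (suc size) → Fin (suc size)
  jn zero    _       = zero
  jn (suc a) zero    = zero
  jn (suc a) (suc b) = suc (a ∨ b)
  mt : Fin (suc size) → Fin (suc size) → Fin (suc size)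
  mt zero    y       = y
  mt (suc a) zero    = suc a
  mt (suc a) (suc b) = suc (a ∧ b)
  -- in H (a Heyting algebra) a ≤ b iff a ⇨ b = ⊤, so the test below is "a ≤ b"
  imp : Fin (suc size) → Fin (suc size) → Fin (suc size)
  imp _       zero    = zero
  imp zero    (suc b) = suc b
  imp (suc a) (suc b) with (a ⇨ b) ≟ ⊤
  ... | yes _ = zero
  ... | no  _ = suc (a ⇨ b)

_⊕[_]⊤ : RawFHA → ℕ → RawFHA
H ⊕[ zero  ]⊤ = H
H ⊕[ suc k ]⊤ = (H ⊕[ k ]⊤) ⊕⊤

HasFiniteGap : Set₁
HasFiniteGap = ∃[ ε ] (0ℚ < ε × ((H : RawFHA) → IsFiniteHA H → ds H ≡ 1ℚ ⊎ ds H ≤ 1ℚ - ε))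

module Submission where

-- In H ⊕ ⊤ the new top is double-dense, the old bottom is not (its negation is the new top),
-- and, when H is nontrivial, every double-dense element of H stays double-dense.  Hence
-- H ⊕ₖ ⊤ has at least k double-dense elements out of k + |H| and at least one element that
-- is not: its density is below 1 but tends to 1, which leaves no room for a gap.

open import Defs
open import Data.Nat as ℕ using (ℕ; zero; suc; _≥_; z≤n; s≤s)
import Data.Nat.Properties as ℕ
open import Data.Fin using (Fin; zero; suc)
open import Data.Fin.Properties using (_≟_; 0≢1+n)
open import Data.Rational using (ℚ; 0ℚ; 1ℚ; _<_; _-_; ∣_∣; ↧ₙ_) renaming (_≤_ to _ℚ≤_)
import Data.Rational.Properties as ℚ
open import Data.List using (length; filter; allFin; tabulate)
open import Data.List.Properties using (filter-notAll; filter-accept; length-tabulate)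
open import Data.List.Membership.Propositional using (lose)
open import Data.List.Membership.Propositional.Properties using (∈-allFin)
open import Data.List.Relation.Binary.Pointwise using (tabulate⁺)
open import Data.List.Relation.Binary.Sublist.Heterogeneous.Properties
  using (length-mono-≤; fromPointwise; ⊆-filter-Sublist)
open import Data.Product using (_×_; ∃-syntax; _,_; proj₁; proj₂)
open import Data.Sum using ([_,_]′)
open import Data.Unit using (tt)
open import Function using (id)
open import Relation.Nullary using (¬_; yes; no)
open import Relation.Unary using (Pred; Decidable)
open import Relation.Binary.PropositionalEquality as ≡ using (_≡_; _≢_)
open import Relation.Binary.Lattice.Bundles using (HeytingAlgebra)
open import Relation.Binary.Lattice.Structures using (IsHeytingAlgebra)

module HeytingAlgebraProperties {c ℓ₁ ℓ₂} (L : HeytingAlgebra c ℓ₁ ℓ₂) where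
  open HeytingAlgebra L

  ⇨≈⊤⇒≤ : ∀ {x y} → x ⇨ y ≈ ⊤ → x ≤ y
  ⇨≈⊤⇒≤ {x} e = trans (∧-greatest (maximum x) refl) (transpose-∧ (reflexive (Eq.sym e)))

  ≤⇒⇨≈⊤ : ∀ {x y} → x ≤ y → x ⇨ y ≈ ⊤
  ≤⇒⇨≈⊤ x≤y = antisym (maximum _) (transpose-⇨ (trans (x∧y≤y _ _) x≤y))

heytingAlgebra : (H : RawFHA) → IsFiniteHA H → HeytingAlgebra _ _ _
heytingAlgebra H isHA = record
  { _≈_ = _≡_ ; _≤_ = _≼_ ; _∨_ = _∨_ ; _∧_ = _∧_ ; _⇨_ = _⇨_ ; ⊤ = ⊤ ; ⊥ = ⊥
  ; isHeytingAlgebra = isHA }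
  where open RawFHA H

DoubleDense : (H : RawFHA) → Pred (Fin (RawFHA.size H)) _
DoubleDense H a = neg H (neg H a) ≡ RawFHA.⊤ H

doubleDense? : (H : RawFHA) → Decidable (DoubleDense H)
doubleDense? H a = neg H (neg H a) ≟ RawFHA.⊤ H

module OrdinalSum (H : RawFHA) (isHA : IsFiniteHA H) where
  open import Data.Empty using (⊥-elim)
  open ≡ using (refl; cong; isEquivalence)
  open import Relation.Binary.Structures using (IsPartialOrder)

  open RawFHA H
  open IsHeytingAlgebra isHA hiding (refl; isEquivalence)
  open HeytingAlgebraProperties (heytingAlgebra H isHA)
  private module L = RawFHA (H ⊕⊤)

  ≼-refl : ∀ x → x L.≼ x
  ≼-refl zero    = tt
  ≼-refl (suc a) = reflexive refl

  ≼-trans : ∀ {x y z} → x L.≼ y → y L.≼ z → x L.≼ z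
  ≼-trans {z = zero}            _ _  = tt
  ≼-trans {zero}  {zero}  {suc _} _  ()
  ≼-trans {zero}  {suc _} {suc _} () _
  ≼-trans {suc _} {zero}  {suc _} _  ()
  ≼-trans {suc _} {suc _} {suc _} p  q = trans p q

  ≼-antisym : ∀ {x y} → x L.≼ y → y L.≼ x → x ≡ y
  ≼-antisym {zero}  {zero}  _  _ = refl
  ≼-antisym {zero}  {suc _} () _
  ≼-antisym {suc _} {zero}  _  ()
  ≼-antisym {suc _} {suc _} p  q = cong suc (antisym p q)

  ≼-isPartialOrder : IsPartialOrder _≡_ L._≼_
  ≼-isPartialOrder = record
    { isPreorder = record
      { isEquivalence = isEquivalence
      ; reflexive     = λ { {x} refl → ≼-refl x }
      ; trans         = λ {x} {y} {z} → ≼-trans {x} {y} {z}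
      }
    ; antisym = λ {x} {y} → ≼-antisym {x} {y}
    }

  supremum′ : ∀ x y → x L.≼ (x L.∨ y) × y L.≼ (x L.∨ y)
                    × (∀ z → x L.≼ z → y L.≼ z → (x L.∨ y) L.≼ z)
  supremum′ zero    _       = tt , tt , λ _ p _ → p
  supremum′ (suc _) zero    = tt , tt , λ _ _ q → q
  supremum′ (suc a) (suc b) = x≤x∨y a b , y≤x∨y a b , λ { zero _ _ → tt ; (suc _) p q → ∨-least p q }

  infimum′ : ∀ x y → (x L.∧ y) L.≼ x × (x L.∧ y) L.≼ y
                   × (∀ z → z L.≼ x → z L.≼ y → z L.≼ (x L.∧ y))
  infimum′ zero    y       = tt , ≼-refl y , λ _ _ q → q
  infimum′ (suc a) zero    = ≼-refl (suc a) , tt , λ _ p _ → p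
  infimum′ (suc a) (suc b) = x∧y≤x a b , x∧y≤y a b , λ { zero () _ ; (suc _) p q → ∧-greatest p q }

  ⊕⊤-⇨-≼ : ∀ {a b} → a ≼ b → suc a L.⇨ suc b ≡ zero
  ⊕⊤-⇨-≼ {a} {b} a≼b with (a ⇨ b) ≟ ⊤
  ... | yes _ = refl
  ... | no a⇨b≢⊤ = ⊥-elim (a⇨b≢⊤ (≤⇒⇨≈⊤ a≼b))

  exponential′ : ∀ w x y → ((w L.∧ x) L.≼ y → w L.≼ (x L.⇨ y)) × (w L.≼ (x L.⇨ y) → (w L.∧ x) L.≼ y)
  exponential′ _       _       zero    = (λ _ → tt) , (λ _ → tt)
  exponential′ zero    zero    (suc _) = (λ p → p) , (λ p → p)
  exponential′ (suc _) zero    (suc _) = (λ p → p) , (λ p → p)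
  exponential′ w       (suc c) (suc b) with (c ⇨ b) ≟ ⊤
  exponential′ zero    (suc c) (suc b) | yes c⇨b≡⊤ = (λ _ → tt) , (λ _ → ⇨≈⊤⇒≤ c⇨b≡⊤)
  exponential′ zero    (suc c) (suc b) | no c⇨b≢⊤  = (λ c≼b → ⊥-elim (c⇨b≢⊤ (≤⇒⇨≈⊤ c≼b))) , λ ()
  exponential′ (suc a) (suc c) (suc b) | yes c⇨b≡⊤ = (λ _ → tt) , (λ _ → trans (x∧y≤y a c) (⇨≈⊤⇒≤ c⇨b≡⊤))
  exponential′ (suc a) (suc c) (suc b) | no _      = transpose-⇨ , transpose-∧

  ⊕⊤-isFiniteHA : IsFiniteHA (H ⊕⊤)
  ⊕⊤-isFiniteHA = record
    { isBoundedLattice = record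
      { isLattice = record
        { isPartialOrder = ≼-isPartialOrder
        ; supremum       = supremum′
        ; infimum        = infimum′
        }
      ; maximum = λ _ → tt
      ; minimum = λ { zero → tt ; (suc b) → minimum b }
      }
    ; exponential = exponential′
    }

  ⊤-doubleDense : DoubleDense (H ⊕⊤) zero
  ⊤-doubleDense = ⊕⊤-⇨-≼ (reflexive refl)

  ⊥-not-doubleDense : ¬ DoubleDense (H ⊕⊤) (suc ⊥)
  ⊥-not-doubleDense ¬¬⊥≡⊤ = 0≢1+n (≡.trans (≡.sym ¬¬⊥≡⊤) (cong (neg (H ⊕⊤)) ⊤-doubleDense))

  ⊕⊤-doubleDense : ⊤ ≢ ⊥ → ∀ {a} → DoubleDense H a → DoubleDense (H ⊕⊤) (suc a)
  ⊕⊤-doubleDense ⊤≢⊥ {a} ¬¬a≡⊤ with (a ⇨ ⊥) ≟ ⊤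
  ... | yes ¬a≡⊤ = ⊥-elim (⊤≢⊥ (antisym (⇨≈⊤⇒≤ (≡.subst (λ b → b ⇨ ⊥ ≡ ⊤) ¬a≡⊤ ¬¬a≡⊤)) (minimum ⊤)))
  ... | no _     = ⊕⊤-⇨-≼ (⇨≈⊤⇒≤ ¬¬a≡⊤)

  countDN-⊕⊤ : countDN (H ⊕⊤) ≡ suc (length (filter (doubleDense? (H ⊕⊤)) (tabulate suc)))
  countDN-⊕⊤ = cong length (filter-accept (doubleDense? (H ⊕⊤)) {x = zero} {xs = tabulate suc} ⊤-doubleDense)

  countDN-⊕⊤-< : countDN (H ⊕⊤) ℕ.< L.size
  countDN-⊕⊤-< = ℕ.<-≤-trans
    (filter-notAll (doubleDense? (H ⊕⊤)) (allFin L.size) (lose (∈-allFin (suc ⊥)) ⊥-not-doubleDense))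
    (ℕ.≤-reflexive (length-tabulate id))

  -- suc embeds the double-dense elements of H among those of H ⊕ ⊤, so the filtered lists form a sublist.
  countDN-⊕⊤-> : ⊤ ≢ ⊥ → countDN H ℕ.< countDN (H ⊕⊤)
  countDN-⊕⊤-> ⊤≢⊥ = ≡.subst (countDN H ℕ.<_) (≡.sym countDN-⊕⊤) (s≤s (length-mono-≤
    (⊆-filter-Sublist (doubleDense? H) (doubleDense? (H ⊕⊤)) (λ { refl → ⊕⊤-doubleDense ⊤≢⊥ })
      (fromPointwise (tabulate⁺ {R = λ a b → suc a ≡ b} {f = id} {g = suc} (λ _ → refl))))))

  countDN-⊕⊤-pos : 0 ℕ.< countDN (H ⊕⊤)
  countDN-⊕⊤-pos = ≡.subst (0 ℕ.<_) (≡.sym countDN-⊕⊤) (s≤s z≤n)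

⊕ₖ⊤-isFiniteHA : ∀ {H} → IsFiniteHA H → ∀ k → IsFiniteHA (H ⊕[ k ]⊤)
⊕ₖ⊤-isFiniteHA isHA zero    = isHA
⊕ₖ⊤-isFiniteHA isHA (suc k) = OrdinalSum.⊕⊤-isFiniteHA _ (⊕ₖ⊤-isFiniteHA isHA k)

size-⊕ₖ⊤ : ∀ H k → RawFHA.size (H ⊕[ k ]⊤) ≡ k ℕ.+ RawFHA.size H
size-⊕ₖ⊤ H zero    = ≡.refl
size-⊕ₖ⊤ H (suc k) = ≡.cong suc (size-⊕ₖ⊤ H k)

countDN-⊕ₖ⊤-≥ : ∀ {H} → IsFiniteHA H → ∀ k → suc k ℕ.≤ countDN (H ⊕[ suc k ]⊤)
countDN-⊕ₖ⊤-≥ isHA zero    = OrdinalSum.countDN-⊕⊤-pos _ isHA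
countDN-⊕ₖ⊤-≥ isHA (suc k) = ℕ.≤-<-trans (countDN-⊕ₖ⊤-≥ isHA k)
  (OrdinalSum.countDN-⊕⊤-> _ (⊕ₖ⊤-isFiniteHA isHA (suc k)) λ ())

countDN-⊕ₖ⊤-< : ∀ {H} → IsFiniteHA H → ∀ k → countDN (H ⊕[ suc k ]⊤) ℕ.< RawFHA.size (H ⊕[ suc k ]⊤)
countDN-⊕ₖ⊤-< isHA k = OrdinalSum.countDN-⊕⊤-< _ (⊕ₖ⊤-isFiniteHA isHA k)

defect-bound : ∀ {c k n d} → k ℕ.≤ c → n ℕ.* d ℕ.< k → (k ℕ.+ n ℕ.∸ c) ℕ.* d ℕ.< k ℕ.+ n
defect-bound {c} {k} {n} {d} k≤c nd<k = begin-strict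
  (k ℕ.+ n ℕ.∸ c) ℕ.* d ≤⟨ ℕ.*-monoˡ-≤ d (ℕ.∸-monoʳ-≤ (k ℕ.+ n) k≤c) ⟩
  (k ℕ.+ n ℕ.∸ k) ℕ.* d ≡⟨ ≡.cong (ℕ._* d) (ℕ.m+n∸m≡n k n) ⟩
  n ℕ.* d               <⟨ nd<k ⟩
  k                     ≤⟨ ℕ.m≤m+n k n ⟩
  k ℕ.+ n               ∎
  where open ℕ.≤-Reasoning

module RatioBounds where
  open import Data.Integer as ℤ using (+_; -[1+_]; +[1+_])
  import Data.Integer.Properties as ℤ
  open import Data.Rational using (mkℚ; _≤_; -_; toℚᵘ; *<*)
  open import Data.Rational.Unnormalised as ℚᵘ using (mkℚᵘ)
  import Data.Rational.Unnormalised.Properties as ℚᵘ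
  open import Data.Rational.Solver using (module +-*-Solver)
  open ≡ using (cong; cong₂)

  ratio-<1 : ∀ {c N} → c ℕ.< N → ratio c N < 1ℚ
  ratio-<1 {c} {suc m} c<N =
    ℚ.toℚᵘ-cancel-< (ℚᵘ.<-respˡ-≃ (ℚᵘ.≃-sym (ℚ.toℚᵘ-fromℚᵘ (mkℚᵘ (+ c) m))) (ℚᵘ.*<* c*1<1*N))
    where
    c*1<1*N : + c ℤ.* + 1 ℤ.< + 1 ℤ.* + suc m
    c*1<1*N = ≡.subst₂ ℤ._<_ (≡.sym (ℤ.*-identityʳ (+ c))) (≡.sym (ℤ.*-identityˡ (+ suc m))) (ℤ.+<+ c<N)

  -- The left-hand side is the numerator that ℚᵘ computes for ∣ c/N - 1 ∣.
  ∣c-N∣≡N∸c : ∀ {c N} → c ℕ.≤ N → ℤ.∣ + c ℤ.* + 1 ℤ.+ ℤ.- (+ 1) ℤ.* + N ∣ ≡ N ℕ.∸ c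
  ∣c-N∣≡N∸c {c} {N} c≤N = begin
    ℤ.∣ + c ℤ.* + 1 ℤ.+ ℤ.- (+ 1) ℤ.* + N ∣ ≡⟨ cong₂ (λ a b → ℤ.∣ a ℤ.+ b ∣) (ℤ.*-identityʳ (+ c)) (ℤ.-1*i≡-i (+ N)) ⟩
    ℤ.∣ + c ℤ.+ ℤ.- (+ N) ∣                 ≡⟨ cong ℤ.∣_∣ (ℤ.m-n≡m⊖n c N) ⟩
    ℤ.∣ c ℤ.⊖ N ∣                           ≡⟨ ℤ.∣⊖∣-≤ c≤N ⟩
    N ℕ.∸ c                                 ∎
    where open ≡.≡-Reasoning

  toℚᵘ-∣ratio-1∣ : ∀ {c m} → c ℕ.≤ suc m → toℚᵘ ∣ ratio c (suc m) - 1ℚ ∣ ℚᵘ.≃ mkℚᵘ (+ (suc m ℕ.∸ c)) m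
  toℚᵘ-∣ratio-1∣ {c} {m} c≤N = ℚᵘ.≃-trans
    (ℚᵘ.≃-trans (ℚ.toℚᵘ-homo-∣-∣ (x - 1ℚ)) (ℚᵘ.∣-∣-cong (ℚᵘ.≃-trans (ℚ.toℚᵘ-homo-+ x (- 1ℚ))
      (ℚᵘ.+-cong (ℚ.toℚᵘ-fromℚᵘ (mkℚᵘ (+ c) m)) (ℚ.toℚᵘ-homo‿- 1ℚ)))))
    (ℚᵘ.≃-reflexive (cong₂ mkℚᵘ (cong +_ (∣c-N∣≡N∸c c≤N)) (ℕ.*-identityʳ m)))
    where x = ratio c (suc m)

  ratio-close-to-1 : ∀ {c N} ε → 0ℚ < ε → c ℕ.≤ N → (N ℕ.∸ c) ℕ.* ↧ₙ ε ℕ.< N → ∣ ratio c N - 1ℚ ∣ < ε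
  ratio-close-to-1 {N = zero} _ _ _ ()
  ratio-close-to-1 {c} {suc m} (mkℚ +[1+ p ] d _) _ c≤N defect<N = ℚ.toℚᵘ-cancel-<
    (ℚᵘ.<-respˡ-≃ (ℚᵘ.≃-sym (toℚᵘ-∣ratio-1∣ c≤N)) (ℚᵘ.*<*
      (≡.subst₂ ℤ._<_ (ℤ.pos-* (suc m ℕ.∸ c) (suc d)) (ℤ.pos-* (suc p) (suc m))
        (ℤ.+<+ (ℕ.<-≤-trans defect<N (ℕ.m≤n*m (suc m) (suc p)))))))
  ratio-close-to-1 (mkℚ (+ zero)   _ _) (*<* (ℤ.+<+ ())) _ _
  ratio-close-to-1 (mkℚ -[1+ _ ] _ _) (*<* ()) _ _

  ε≤∣x-1∣ : ∀ {x ε} → 0ℚ ≤ ε → x ≤ 1ℚ - ε → ε ≤ ∣ x - 1ℚ ∣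
  ε≤∣x-1∣ {x} {ε} 0≤ε x≤1-ε = begin
    ε               ≤⟨ ε≤1-x ⟩
    1ℚ - x          ≡⟨ ≡.sym (ℚ.0≤p⇒∣p∣≡p (ℚ.≤-trans 0≤ε ε≤1-x)) ⟩
    ∣ 1ℚ - x ∣      ≡⟨ cong ∣_∣ (solve 1 (λ y → con 1ℚ :- y := :- (y :- con 1ℚ)) ≡.refl x) ⟩
    ∣ - (x - 1ℚ) ∣  ≡⟨ ℚ.∣-p∣≡∣p∣ (x - 1ℚ) ⟩
    ∣ x - 1ℚ ∣      ∎
    where
    open +-*-Solver
    open ℚ.≤-Reasoning
    ε≤1-x : ε ≤ 1ℚ - x
    ε≤1-x = begin
      ε              ≡⟨ solve 1 (λ e → e := con 1ℚ :- (con 1ℚ :- e)) ≡.refl ε ⟩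
      1ℚ - (1ℚ - ε)  ≤⟨ ℚ.+-monoʳ-≤ 1ℚ (ℚ.neg-antimono-≤ x≤1-ε) ⟩
      1ℚ - x         ∎

open RatioBounds using (ratio-<1; ratio-close-to-1; ε≤∣x-1∣)

ds-⊕ₖ⊤-<1 : (H : RawFHA) → IsFiniteHA H → (k : ℕ) → k ≥ 1 → ds (H ⊕[ k ]⊤) < 1ℚ
ds-⊕ₖ⊤-<1 H isHA (suc k) _ = ratio-<1 (countDN-⊕ₖ⊤-< isHA k)

-- Past K = 1 + |H| · den ε the at most |H| elements that are not double-dense make up less than ε.
ds-⊕ₖ⊤-close-to-1 : (H : RawFHA) → IsFiniteHA H → (ε : ℚ) → 0ℚ < ε →
  ∃[ K ] ((k : ℕ) → k ≥ K → ∣ ds (H ⊕[ k ]⊤) - 1ℚ ∣ < ε)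
ds-⊕ₖ⊤-close-to-1 H isHA ε 0<ε = suc (RawFHA.size H ℕ.* ↧ₙ ε) , λ where
  (suc k) K≤k → ratio-close-to-1 ε 0<ε (ℕ.<⇒≤ (countDN-⊕ₖ⊤-< isHA k))
    (≡.subst (λ N → (N ℕ.∸ countDN (H ⊕[ suc k ]⊤)) ℕ.* ↧ₙ ε ℕ.< N) (≡.sym (size-⊕ₖ⊤ H (suc k)))
      (defect-bound (countDN-⊕ₖ⊤-≥ isHA k) K≤k))

trivialHA : RawFHA
trivialHA = record
  { size = 1 ; _≼_ = λ _ _ → ⊤ ; _∨_ = λ _ _ → zero ; _∧_ = λ _ _ → zero ; _⇨_ = λ _ _ → zero
  ; ⊤ = zero ; ⊥ = zero }
  where open import Data.Unit using (⊤)

trivialHA-isFiniteHA : IsFiniteHA trivialHA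
trivialHA-isFiniteHA = record
  { isBoundedLattice = record
    { isLattice = record
      { isPartialOrder = record
        { isPreorder = record { isEquivalence = ≡.isEquivalence ; reflexive = λ _ → tt ; trans = λ _ _ → tt }
        ; antisym    = λ { {zero} {zero} _ _ → ≡.refl }
        }
      ; supremum = λ _ _ → tt , tt , λ _ _ _ → tt
      ; infimum  = λ _ _ → tt , tt , λ _ _ _ → tt
      }
    ; maximum = λ _ → tt
    ; minimum = λ _ → tt
    }
  ; exponential = λ _ _ _ → (λ _ → tt) , (λ _ → tt)
  }

¬HasFiniteGap : ¬ HasFiniteGap
¬HasFiniteGap (ε , 0<ε , gap) = [ ds≢1 , ds≰1-ε ]′ (gap X (⊕ₖ⊤-isFiniteHA trivialHA-isFiniteHA (suc K)))
  where
  converges : ∃[ K ] ((k : ℕ) → k ≥ K → ∣ ds (trivialHA ⊕[ k ]⊤) - 1ℚ ∣ < ε)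
  converges = ds-⊕ₖ⊤-close-to-1 trivialHA trivialHA-isFiniteHA ε 0<ε
  K : ℕ
  K = proj₁ converges
  X : RawFHA
  X = trivialHA ⊕[ suc K ]⊤
  ds≢1 : ds X ≢ 1ℚ
  ds≢1 ds≡1 = ℚ.<-irrefl ds≡1 (ds-⊕ₖ⊤-<1 trivialHA trivialHA-isFiniteHA (suc K) (s≤s z≤n))
  ds≰1-ε : ¬ (ds X ℚ≤ 1ℚ - ε)
  ds≰1-ε ds≤1-ε = ℚ.<-irrefl ≡.refl
    (ℚ.≤-<-trans (ε≤∣x-1∣ (ℚ.<⇒≤ 0<ε) ds≤1-ε) (proj₂ converges (suc K) (ℕ.n≤1+n K)))

proposition2p11 : ¬ HasFiniteGap
    × ((H : RawFHA) → IsFiniteHA H → (k : ℕ) → k ≥ 1 → ds (H ⊕[ k ]⊤) < 1ℚ)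
    × ((H : RawFHA) → IsFiniteHA H → (ε : ℚ) → 0ℚ < ε →
        ∃[ K ] ((k : ℕ) → k ≥ K → ∣ ds (H ⊕[ k ]⊤) - 1ℚ ∣ < ε))
proposition2p11 = ¬HasFiniteGap , ds-⊕ₖ⊤-<1 , ds-⊕ₖ⊤-close-to-1
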